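{- Let $q_1,\dots,q_n,q,p$ be terms in the language $\langle\to,\neg,{}^+,{}^-,1\rangle$. Then: (1) if $q_1,\dots,q_n\vDash_{\mathbb{SQW}^*}q$, then $q_1,\dots,q_n\vDash_{\mathbb{W}^*}q$; (2) $q_1,\dots,q_n\vDash_{\mathbb{W}^*}q$ if and only if $q_1,\dots,q_n\vDash_{\mathbb{SQW}^*}(p\to p)\to q$; (3) if $q$ is regular, then $q_1,\dots,q_n\vDash_{\mathbb{W}^*}q$ if and only if $q_1,\dots,q_n\vDash_{\mathbb{SQW}^*}q$.
   Context: A quasi-Wajsberg* algebra is an algebra $\langle W;\to,\neg,{}^+,{}^-,1\rangle$ of type $\langle2,1,1,1,0\rangle$ such that for all $x,y,z$: (QW*1) $x\to y=\neg y\to\neg x$; (QW*2) $(x\to1)\to((y\to1)\to z)=(y\to1)\to((x\to1)\to z)$; (QW*3) $(1\to x)\to1=1$; (QW*4) $(z\to z)\to(x\to y)=x\to y$; (QW*5) $(1\to1)\to x^+=((1\to1)\to x)^+=(x\to1)\to1$ and $(1\to1)\to x^-=((1\to1)\to x)^-=(x\to\neg1)\to\neg1$; (QW*6) $x\to y=(y^+\to x^-)\to(x^+\to y^-)$; (QW*7) $\neg(x\to y)=y\to x$; (QW*8) $\neg\neg x=x$; (QW*9) $(x\to(\neg x\to y))^+=x^+\to(\neg x^+\to y^+)$; (QW*10)–(QW*12) $\vee$ is commutative, associative, and $x\to(y\vee z)=(x\to y)\vee(x\to z)$; where $x\vee y:=((x^+\to y^+)^+\to(\neg x)^-)\to((y^-\to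 x^-)^-\to x^-)$. It is strong if $x^+=(1\to1)\to x^+$ and $x^-=(1\to1)\to x^-$ for all $x$; $\mathbb{SQW}^*$ is the variety of strong quasi-Wajsberg* algebras. A Wajsberg* algebra is an algebra $\langle M;\to,\neg,1\rangle$ satisfying for all $x,y,z$: $x\to y=\neg y\to\neg x$; $(x\to1)\to((y\to1)\to z)=(y\to1)\to((x\to1)\to z)$; $(1\to x)\to1=1$; $(y\to y)\to x=x$; $x\to y=(y^+\to x^-)\to(x^+\to y^-)$; $\neg(x\to y)=y\to x$; $\neg\neg x=x$; $(x\to(\neg x\to y))^+=x^+\to(\neg x^+\to y^+)$; $\vee$ commutative and associative; $x\to(y\vee z)=(x\to y)\vee(x\to z)$; where $x^+:=(x\to1)\to1$, $x^-:=(x\to\neg1)\to\neg1$; regarded with these term operations ${}^+,{}^-$. $\mathbb{W}^*$ is the variety of Wajsberg* algebras. A term is regular if it contains an occurrence of $\to$ or of $1$. For a variety $\mathbb{K}\in\{\mathbb{SQW}^*,\mathbb{W}^*\}$, $t_1,\dots,t_n\vDash_{\mathbb{K}}t$ means $\mathbb{K}\models t_1\approx(c_1\to1)\to1\ \&\cdots\&\ t_n\approx(c_n\to1)\to1\Rightarrow t\approx(c\to1)\to1$, where $c_1,\dots,c_n,c$ are constants denoting designated elements; i.e. in every $\mathbf{A}\in\mathbb{K}$ under every assignment, if each $t_i$ takes a value of the form $(a_i\to1)\to1$ ($a_i\in A$), then $t$ takes a value of the form $(a\to1)\to1$ ($a\in A$). -}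

module Defs where

open import Level using (Level; suc; _⊔_)
open import Data.Nat using (ℕ)
open import Data.Product using (Σ; _×_)
open import Data.Sum using (_⊎_)
open import Data.List using (List)
open import Data.List.Relation.Unary.All using (All)
open import Relation.Binary.PropositionalEquality using (_≡_)

data Term : Set where
  var  : ℕ → Term
  _⇛_  : Term → Term → Term
  ¬ₜ_  : Term → Term
  _⁺ₜ  : Term → Term
  _⁻ₜ  : Term → Term
  1ₜ   : Term

infixr 5 _⇛_

-- A term is regular if it contains an occurrence of → or of 1.
data Regular : Term → Set where
  reg-⇛   : ∀ {s t} → Regular (s ⇛ t)
  reg-1   : Regular 1ₜ
  reg-¬   : ∀ {t} → Regular t → Regular (¬ₜ t)
  reg-⁺   : ∀ {t} → Regular t → Regular (t ⁺ₜ)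
  reg-⁻   : ∀ {t} → Regular t → Regular (t ⁻ₜ)

record QWAlg (ℓ : Level) : Set (suc ℓ) where
  infixr 5 _⇒_
  field
    Carrier : Set ℓ
    _⇒_  : Carrier → Carrier → Carrier
    ~_   : Carrier → Carrier
    _⁺   : Carrier → Carrier
    _⁻   : Carrier → Carrier
    one  : Carrier

  _∨_ : Carrier → Carrier → Carrier
  x ∨ y = (((x ⁺ ⇒ y ⁺) ⁺) ⇒ ((~ x) ⁻)) ⇒ (((y ⁻ ⇒ x ⁻) ⁻) ⇒ x ⁻)

  field
    qw1  : ∀ x y → x ⇒ y ≡ (~ y) ⇒ (~ x)
    qw2  : ∀ x y z → (x ⇒ one) ⇒ ((y ⇒ one) ⇒ z) ≡ (y ⇒ one) ⇒ ((x ⇒ one) ⇒ z)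
    qw3  : ∀ x → (one ⇒ x) ⇒ one ≡ one
    qw4  : ∀ x y z → (z ⇒ z) ⇒ (x ⇒ y) ≡ x ⇒ y
    qw5a : ∀ x → (one ⇒ one) ⇒ (x ⁺) ≡ ((one ⇒ one) ⇒ x) ⁺
    qw5b : ∀ x → ((one ⇒ one) ⇒ x) ⁺ ≡ (x ⇒ one) ⇒ one
    qw5c : ∀ x → (one ⇒ one) ⇒ (x ⁻) ≡ ((one ⇒ one) ⇒ x) ⁻
    qw5d : ∀ x → ((one ⇒ one) ⇒ x) ⁻ ≡ (x ⇒ (~ one)) ⇒ (~ one)
    qw6  : ∀ x y → x ⇒ y ≡ ((y ⁺) ⇒ (x ⁻)) ⇒ ((x ⁺) ⇒ (y ⁻))
    qw7  : ∀ x y → ~ (x ⇒ y) ≡ y ⇒ x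
    qw8  : ∀ x → ~ (~ x) ≡ x
    qw9  : ∀ x y → (x ⇒ ((~ x) ⇒ y)) ⁺ ≡ (x ⁺) ⇒ ((~ (x ⁺)) ⇒ (y ⁺))
    qw10 : ∀ x y → x ∨ y ≡ y ∨ x
    qw11 : ∀ x y z → x ∨ (y ∨ z) ≡ (x ∨ y) ∨ z
    qw12 : ∀ x y z → x ⇒ (y ∨ z) ≡ (x ⇒ y) ∨ (x ⇒ z)

record SQWAlg (ℓ : Level) : Set (suc ℓ) where
  field
    alg : QWAlg ℓ
  open QWAlg alg
  field
    strong⁺ : ∀ x → x ⁺ ≡ (one ⇒ one) ⇒ (x ⁺)
    strong⁻ : ∀ x → x ⁻ ≡ (one ⇒ one) ⇒ (x ⁻)

record WAlg (ℓ : Level) : Set (suc ℓ) where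
  infixr 5 _⇒_
  field
    Carrier : Set ℓ
    _⇒_  : Carrier → Carrier → Carrier
    ~_   : Carrier → Carrier
    one  : Carrier

  _⁺ : Carrier → Carrier
  x ⁺ = (x ⇒ one) ⇒ one

  _⁻ : Carrier → Carrier
  x ⁻ = (x ⇒ (~ one)) ⇒ (~ one)

  _∨_ : Carrier → Carrier → Carrier
  x ∨ y = (((x ⁺ ⇒ y ⁺) ⁺) ⇒ ((~ x) ⁻)) ⇒ (((y ⁻ ⇒ x ⁻) ⁻) ⇒ x ⁻)

  field
    w1  : ∀ x y → x ⇒ y ≡ (~ y) ⇒ (~ x)
    w2  : ∀ x y z → (x ⇒ one) ⇒ ((y ⇒ one) ⇒ z) ≡ (y ⇒ one) ⇒ ((x ⇒ one) ⇒ z)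
    w3  : ∀ x → (one ⇒ x) ⇒ one ≡ one
    w4  : ∀ x y → (y ⇒ y) ⇒ x ≡ x
    w5  : ∀ x y → x ⇒ y ≡ ((y ⁺) ⇒ (x ⁻)) ⇒ ((x ⁺) ⇒ (y ⁻))
    w6  : ∀ x y → ~ (x ⇒ y) ≡ y ⇒ x
    w7  : ∀ x → ~ (~ x) ≡ x
    w8  : ∀ x y → (x ⇒ ((~ x) ⇒ y)) ⁺ ≡ (x ⁺) ⇒ ((~ (x ⁺)) ⇒ (y ⁺))
    w9  : ∀ x y → x ∨ y ≡ y ∨ x
    w10 : ∀ x y z → x ∨ (y ∨ z) ≡ (x ∨ y) ∨ z
    w11 : ∀ x y z → x ⇒ (y ∨ z) ≡ (x ⇒ y) ∨ (x ⇒ z)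

module EvalQW {ℓ} (A : QWAlg ℓ) where
  open QWAlg A renaming (_⇒_ to _⇒ᴬ_; ~_ to ~ᴬ_; _⁺ to _⁺ᴬ; _⁻ to _⁻ᴬ; one to oneᴬ)

  eval : (ℕ → Carrier) → Term → Carrier
  eval ρ (var i) = ρ i
  eval ρ (s ⇛ t) = eval ρ s ⇒ᴬ eval ρ t
  eval ρ (¬ₜ t)  = ~ᴬ eval ρ t
  eval ρ (t ⁺ₜ)  = eval ρ t ⁺ᴬ
  eval ρ (t ⁻ₜ)  = eval ρ t ⁻ᴬ
  eval ρ 1ₜ      = oneᴬ

  Designated : Carrier → Set ℓ
  Designated v = Σ Carrier (λ a → v ≡ (a ⇒ᴬ oneᴬ) ⇒ᴬ oneᴬ)

module EvalW {ℓ} (A : WAlg ℓ) where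
  open WAlg A renaming (_⇒_ to _⇒ᴬ_; ~_ to ~ᴬ_; _⁺ to _⁺ᴬ; _⁻ to _⁻ᴬ; one to oneᴬ)

  eval : (ℕ → Carrier) → Term → Carrier
  eval ρ (var i) = ρ i
  eval ρ (s ⇛ t) = eval ρ s ⇒ᴬ eval ρ t
  eval ρ (¬ₜ t)  = ~ᴬ eval ρ t
  eval ρ (t ⁺ₜ)  = eval ρ t ⁺ᴬ
  eval ρ (t ⁻ₜ)  = eval ρ t ⁻ᴬ
  eval ρ 1ₜ      = oneᴬ

  Designated : Carrier → Set ℓ
  Designated v = Σ Carrier (λ a → v ≡ (a ⇒ᴬ oneᴬ) ⇒ᴬ oneᴬ)

_⊨SQW[_]_ : List Term → (ℓ : Level) → Term → Set (suc ℓ)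
qs ⊨SQW[ ℓ ] q =
  (A : SQWAlg ℓ) → let open EvalQW (SQWAlg.alg A) in
  (ρ : ℕ → QWAlg.Carrier (SQWAlg.alg A)) →
  All (λ t → Designated (eval ρ t)) qs → Designated (eval ρ q)

_⊨W[_]_ : List Term → (ℓ : Level) → Term → Set (suc ℓ)
qs ⊨W[ ℓ ] q =
  (A : WAlg ℓ) → let open EvalW A in
  (ρ : ℕ → WAlg.Carrier A) →
  All (λ t → Designated (eval ρ t)) qs → Designated (eval ρ q)

-- A W* algebra is a strong QW* algebra in which (y → y) → x = x, with the same term
-- operations, so SQW*-consequences are W*-consequences.  Conversely, in a strong QW*
-- algebra A the map reg x = (1 → 1) → x is idempotent, fixes every value of the form
-- x → y, 1, x⁺, x⁻, commutes with ¬, and satisfies x → y = reg x → reg y; hence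
-- its fixed points form a W* algebra onto which reg sends the value of every term.
-- Designated values are preserved by reg, and a designated value of reg q in the fixed
-- points is a designated value of (1 → 1) → q = (p → p) → q in A; for regular q this
-- is q itself.
module Submission where

open import Axiom.UniquenessOfIdentityProofs.WithK using (uip)
open import Data.List using (List)
open import Data.List.Relation.Unary.All using (All) renaming (map to All-map)
open import Data.Product using (Σ; _×_; _,_; proj₁)
open import Function using (_∘_)
open import Function.Bundles using (_⇔_; mk⇔)
open import Level using (Level)
open import Relation.Binary.PropositionalEquality
open import Defs

module _ {ℓ} (M : WAlg ℓ) where
  open WAlg M

  WAlg→SQWAlg : SQWAlg ℓ
  WAlg→SQWAlg = record
    { alg = record
      { Carrier = Carrier ; _⇒_ = _⇒_ ; ~_ = ~_ ; _⁺ = _⁺ ; _⁻ = _⁻ ; one = one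
      ; qw1 = w1 ; qw2 = w2 ; qw3 = w3
      ; qw4 = λ x y z → w4 (x ⇒ y) z
      ; qw5a = λ x → trans (w4 (x ⁺) one) (sym (cong _⁺ (w4 x one)))
      ; qw5b = λ x → cong _⁺ (w4 x one)
      ; qw5c = λ x → trans (w4 (x ⁻) one) (sym (cong _⁻ (w4 x one)))
      ; qw5d = λ x → cong _⁻ (w4 x one)
      ; qw6 = w5 ; qw7 = w6 ; qw8 = w7 ; qw9 = w8 ; qw10 = w9 ; qw11 = w10 ; qw12 = w11 }
    ; strong⁺ = λ x → sym (w4 (x ⁺) one)
    ; strong⁻ = λ x → sym (w4 (x ⁻) one) }

  eval-WAlg→SQWAlg : ∀ ρ t → EvalQW.eval (SQWAlg.alg WAlg→SQWAlg) ρ t ≡ EvalW.eval M ρ t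
  eval-WAlg→SQWAlg ρ (var i) = refl
  eval-WAlg→SQWAlg ρ (s ⇛ t) = cong₂ _⇒_ (eval-WAlg→SQWAlg ρ s) (eval-WAlg→SQWAlg ρ t)
  eval-WAlg→SQWAlg ρ (¬ₜ t)  = cong ~_ (eval-WAlg→SQWAlg ρ t)
  eval-WAlg→SQWAlg ρ (t ⁺ₜ)  = cong _⁺ (eval-WAlg→SQWAlg ρ t)
  eval-WAlg→SQWAlg ρ (t ⁻ₜ)  = cong _⁻ (eval-WAlg→SQWAlg ρ t)
  eval-WAlg→SQWAlg ρ 1ₜ      = refl

⊨W-of-⊨SQW : ∀ {ℓ qs} (q′ q : Term) → qs ⊨SQW[ ℓ ] q′ →
             (∀ (M : WAlg ℓ) ρ → EvalW.eval M ρ q′ ≡ EvalW.eval M ρ q) →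
             qs ⊨W[ ℓ ] q
⊨W-of-⊨SQW q′ q H q′≡q M ρ hyps =
  subst Designated (trans (eval-WAlg→SQWAlg M ρ q′) (q′≡q M ρ))
    (H (WAlg→SQWAlg M) ρ (All-map (λ {t} → subst Designated (sym (eval-WAlg→SQWAlg M ρ t))) hyps))
  where open EvalW M using (Designated)

module RegularPart {ℓ} (A : SQWAlg ℓ) where
  open SQWAlg A
  open QWAlg alg
  open EvalQW alg

  reg : Carrier → Carrier
  reg x = (one ⇒ one) ⇒ x

  _⁺′ _⁻′ : Carrier → Carrier
  x ⁺′ = (x ⇒ one) ⇒ one
  x ⁻′ = (x ⇒ ~ one) ⇒ ~ one

  ⁺-def : ∀ x → x ⁺ ≡ x ⁺′
  ⁺-def x = trans (strong⁺ x) (trans (qw5a x) (qw5b x))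

  ⁻-def : ∀ x → x ⁻ ≡ x ⁻′
  ⁻-def x = trans (strong⁻ x) (trans (qw5c x) (qw5d x))

  reg-⇒ : ∀ x y → reg (x ⇒ y) ≡ x ⇒ y
  reg-⇒ x y = qw4 x y one

  reg-idem : ∀ x → reg (reg x) ≡ reg x
  reg-idem = reg-⇒ (one ⇒ one)

  reg-one : reg one ≡ one
  reg-one = qw3 one

  reg-~ : ∀ x → reg (~ x) ≡ ~ reg x
  reg-~ x = begin
    (one ⇒ one) ⇒ ~ x        ≡⟨ qw1 (one ⇒ one) (~ x) ⟩
    ~ ~ x ⇒ ~ (one ⇒ one)    ≡⟨ cong₂ _⇒_ (qw8 x) (qw7 one one) ⟩
    x ⇒ (one ⇒ one)          ≡⟨ qw7 (one ⇒ one) x ⟨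
    ~ reg x                  ∎
    where open ≡-Reasoning

  reg∘⁺ : ∀ x → reg (x ⁺) ≡ x ⁺
  reg∘⁺ x = sym (strong⁺ x)

  reg∘⁻ : ∀ x → reg (x ⁻) ≡ x ⁻
  reg∘⁻ x = sym (strong⁻ x)

  -- qw6 shows that x → y only depends on x⁺, x⁻, y⁺, y⁻, all of which reg leaves unchanged.
  ⇒-reg : ∀ x y → reg x ⇒ reg y ≡ x ⇒ y
  ⇒-reg x y = begin
    reg x ⇒ reg y                                              ≡⟨ qw6 (reg x) (reg y) ⟩
    (reg y ⁺ ⇒ reg x ⁻) ⇒ (reg x ⁺ ⇒ reg y ⁻)                  ≡⟨ cong₂ _⇒_ (cong₂ _⇒_ (⁺∘reg y) (⁻∘reg x))
                                                                             (cong₂ _⇒_ (⁺∘reg x) (⁻∘reg y)) ⟩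
    (y ⁺ ⇒ x ⁻) ⇒ (x ⁺ ⇒ y ⁻)                                  ≡⟨ qw6 x y ⟨
    x ⇒ y                                                      ∎
    where
    open ≡-Reasoning
    ⁺∘reg : ∀ x → reg x ⁺ ≡ x ⁺
    ⁺∘reg x = trans (qw5b x) (sym (⁺-def x))
    ⁻∘reg : ∀ x → reg x ⁻ ≡ x ⁻
    ⁻∘reg x = trans (qw5d x) (sym (⁻-def x))

  reg-⇒ˡ : ∀ x y → reg x ⇒ y ≡ x ⇒ y
  reg-⇒ˡ x y = begin
    reg x ⇒ y               ≡⟨ ⇒-reg (reg x) y ⟨
    reg (reg x) ⇒ reg y     ≡⟨ cong (_⇒ reg y) (reg-idem x) ⟩
    reg x ⇒ reg y           ≡⟨ ⇒-reg x y ⟩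
    x ⇒ y                   ∎
    where open ≡-Reasoning

  ⇒-self-⇒ : ∀ z x → (z ⇒ z) ⇒ x ≡ reg x
  ⇒-self-⇒ z x = begin
    (z ⇒ z) ⇒ x                   ≡⟨ ⇒-reg (z ⇒ z) x ⟨
    reg (z ⇒ z) ⇒ reg x           ≡⟨ cong (_⇒ reg x) (reg-⇒ z z) ⟩
    (z ⇒ z) ⇒ ((one ⇒ one) ⇒ x)   ≡⟨ qw4 (one ⇒ one) x z ⟩
    reg x                         ∎
    where open ≡-Reasoning

  reg-eval : ∀ ρ t → Regular t → reg (eval ρ t) ≡ eval ρ t
  reg-eval ρ (s ⇛ t) reg-⇛     = reg-⇒ _ _
  reg-eval ρ 1ₜ      reg-1     = reg-one
  reg-eval ρ (¬ₜ t)  (reg-¬ g) = trans (reg-~ _) (cong ~_ (reg-eval ρ t g))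
  reg-eval ρ (t ⁺ₜ)  (reg-⁺ g) = reg∘⁺ _
  reg-eval ρ (t ⁻ₜ)  (reg-⁻ g) = reg∘⁻ _

  Fix : Set ℓ
  Fix = Σ Carrier (λ x → reg x ≡ x)

  Fix-≡ : {a b : Fix} → proj₁ a ≡ proj₁ b → a ≡ b
  Fix-≡ {x , p} {.x , q} refl = cong (x ,_) (uip p q)

  toFix : Carrier → Fix
  toFix x = reg x , reg-idem x

  -- The join of FixAlg on first components.
  _∨′_ : Carrier → Carrier → Carrier
  x ∨′ y = ((x ⁺′ ⇒ y ⁺′) ⁺′ ⇒ (~ x) ⁻′) ⇒ ((y ⁻′ ⇒ x ⁻′) ⁻′ ⇒ x ⁻′)

  ∨≡∨′ : ∀ x y → x ∨ y ≡ x ∨′ y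
  ∨≡∨′ x y = cong₂ _⇒_
    (cong₂ _⇒_ (trans (⁺-def _) (cong _⁺′ (cong₂ _⇒_ (⁺-def x) (⁺-def y)))) (⁻-def (~ x)))
    (cong₂ _⇒_ (trans (⁻-def _) (cong _⁻′ (cong₂ _⇒_ (⁻-def y) (⁻-def x)))) (⁻-def x))

  FixAlg : WAlg ℓ
  FixAlg = record
    { Carrier = Fix
    ; _⇒_ = λ (x , _) (y , _) → x ⇒ y , reg-⇒ x y
    ; ~_ = λ (x , rx≡x) → ~ x , trans (reg-~ x) (cong ~_ rx≡x)
    ; one = one , reg-one
    ; w1 = λ a b → Fix-≡ (qw1 (proj₁ a) (proj₁ b))
    ; w2 = λ a b c → Fix-≡ (qw2 (proj₁ a) (proj₁ b) (proj₁ c))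
    ; w3 = λ a → Fix-≡ (qw3 (proj₁ a))
    ; w4 = λ (x , rx≡x) b → Fix-≡ (trans (⇒-self-⇒ (proj₁ b) x) rx≡x)
    ; w5 = λ a b → Fix-≡ (qw6′ (proj₁ a) (proj₁ b))
    ; w6 = λ a b → Fix-≡ (qw7 (proj₁ a) (proj₁ b))
    ; w7 = λ a → Fix-≡ (qw8 (proj₁ a))
    ; w8 = λ a b → Fix-≡ (qw9′ (proj₁ a) (proj₁ b))
    ; w9 = λ a b → Fix-≡ (qw10′ (proj₁ a) (proj₁ b))
    ; w10 = λ a b c → Fix-≡ (qw11′ (proj₁ a) (proj₁ b) (proj₁ c))
    ; w11 = λ a b c → Fix-≡ (qw12′ (proj₁ a) (proj₁ b) (proj₁ c))
    }
    where
    qw6′ : ∀ x y → x ⇒ y ≡ (y ⁺′ ⇒ x ⁻′) ⇒ (x ⁺′ ⇒ y ⁻′)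
    qw6′ x y = trans (qw6 x y)
      (cong₂ _⇒_ (cong₂ _⇒_ (⁺-def y) (⁻-def x)) (cong₂ _⇒_ (⁺-def x) (⁻-def y)))

    qw9′ : ∀ x y → (x ⇒ (~ x ⇒ y)) ⁺′ ≡ x ⁺′ ⇒ (~ (x ⁺′) ⇒ y ⁺′)
    qw9′ x y = trans (sym (⁺-def _)) (trans (qw9 x y)
      (cong₂ _⇒_ (⁺-def x) (cong₂ _⇒_ (cong ~_ (⁺-def x)) (⁺-def y))))

    qw10′ : ∀ x y → x ∨′ y ≡ y ∨′ x
    qw10′ x y = trans (sym (∨≡∨′ x y)) (trans (qw10 x y) (∨≡∨′ y x))

    qw11′ : ∀ x y z → x ∨′ (y ∨′ z) ≡ (x ∨′ y) ∨′ z
    qw11′ x y z = begin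
      x ∨′ (y ∨′ z)   ≡⟨ cong (x ∨′_) (∨≡∨′ y z) ⟨
      x ∨′ (y ∨ z)    ≡⟨ ∨≡∨′ x (y ∨ z) ⟨
      x ∨ (y ∨ z)     ≡⟨ qw11 x y z ⟩
      (x ∨ y) ∨ z     ≡⟨ cong (_∨ z) (∨≡∨′ x y) ⟩
      (x ∨′ y) ∨ z    ≡⟨ ∨≡∨′ (x ∨′ y) z ⟩
      (x ∨′ y) ∨′ z   ∎
      where open ≡-Reasoning

    qw12′ : ∀ x y z → x ⇒ (y ∨′ z) ≡ (x ⇒ y) ∨′ (x ⇒ z)
    qw12′ x y z = trans (cong (x ⇒_) (sym (∨≡∨′ y z))) (trans (qw12 x y z) (∨≡∨′ _ _))

  module F = EvalW FixAlg

  eval-toFix : ∀ ρ t → proj₁ (F.eval (toFix ∘ ρ) t) ≡ reg (eval ρ t)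
  eval-toFix ρ (var i) = refl
  eval-toFix ρ (s ⇛ t) = begin
    proj₁ (F.eval (toFix ∘ ρ) s) ⇒ proj₁ (F.eval (toFix ∘ ρ) t)  ≡⟨ cong₂ _⇒_ (eval-toFix ρ s) (eval-toFix ρ t) ⟩
    reg (eval ρ s) ⇒ reg (eval ρ t)                              ≡⟨ ⇒-reg _ _ ⟩
    eval ρ s ⇒ eval ρ t                                          ≡⟨ reg-⇒ _ _ ⟨
    reg (eval ρ s ⇒ eval ρ t)                                    ∎
    where open ≡-Reasoning
  eval-toFix ρ (¬ₜ t) = trans (cong ~_ (eval-toFix ρ t)) (sym (reg-~ _))
  eval-toFix ρ (t ⁺ₜ) = begin
    proj₁ (F.eval (toFix ∘ ρ) t) ⁺′   ≡⟨ cong _⁺′ (eval-toFix ρ t) ⟩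
    (reg (eval ρ t) ⇒ one) ⇒ one      ≡⟨ cong (_⇒ one) (reg-⇒ˡ _ one) ⟩
    eval ρ t ⁺′                        ≡⟨ ⁺-def _ ⟨
    eval ρ t ⁺                         ≡⟨ reg∘⁺ _ ⟨
    reg (eval ρ t ⁺)                   ∎
    where open ≡-Reasoning
  eval-toFix ρ (t ⁻ₜ) = begin
    proj₁ (F.eval (toFix ∘ ρ) t) ⁻′   ≡⟨ cong _⁻′ (eval-toFix ρ t) ⟩
    (reg (eval ρ t) ⇒ ~ one) ⇒ ~ one  ≡⟨ cong (_⇒ ~ one) (reg-⇒ˡ _ (~ one)) ⟩
    eval ρ t ⁻′                        ≡⟨ ⁻-def _ ⟨
    eval ρ t ⁻                         ≡⟨ reg∘⁻ _ ⟨
    reg (eval ρ t ⁻)                   ∎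
    where open ≡-Reasoning
  eval-toFix ρ 1ₜ = sym reg-one

  toFix-designated : ∀ ρ t → Designated (eval ρ t) → F.Designated (F.eval (toFix ∘ ρ) t)
  toFix-designated ρ t (a , t≡a⁺′) = toFix a , Fix-≡ (begin
    proj₁ (F.eval (toFix ∘ ρ) t)   ≡⟨ eval-toFix ρ t ⟩
    reg (eval ρ t)                 ≡⟨ cong reg t≡a⁺′ ⟩
    reg (a ⁺′)                     ≡⟨ reg-⇒ _ one ⟩
    a ⁺′                           ≡⟨ cong (_⇒ one) (reg-⇒ˡ a one) ⟨
    (reg a) ⁺′                     ∎)
    where open ≡-Reasoning

  designated-of-toFix : ∀ ρ t → F.Designated (F.eval (toFix ∘ ρ) t) → Designated (reg (eval ρ t))
  designated-of-toFix ρ t ((b , _) , t≡b⁺′) = b , trans (sym (eval-toFix ρ t)) (cong proj₁ t≡b⁺′)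

⊨SQW-of-⊨W : ∀ {ℓ qs} (q q′ : Term) → qs ⊨W[ ℓ ] q →
             (∀ (A : SQWAlg ℓ) ρ → let open EvalQW (SQWAlg.alg A) in
                RegularPart.reg A (eval ρ q) ≡ eval ρ q′) →
             qs ⊨SQW[ ℓ ] q′
⊨SQW-of-⊨W q q′ H rq≡q′ A ρ hyps =
  subst Designated (rq≡q′ A ρ)
    (designated-of-toFix ρ q (H FixAlg (toFix ∘ ρ) (All-map (λ {t} → toFix-designated ρ t) hyps)))
  where open RegularPart A
        open EvalQW (SQWAlg.alg A) using (Designated)

lemma3p5 : ∀ (ℓ : Level) (qs : List Term) (q p : Term) →
    ((qs ⊨SQW[ ℓ ] q) → (qs ⊨W[ ℓ ] q))
    × ((qs ⊨W[ ℓ ] q) ⇔ (qs ⊨SQW[ ℓ ] ((p ⇛ p) ⇛ q)))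
    × (Regular q → ((qs ⊨W[ ℓ ] q) ⇔ (qs ⊨SQW[ ℓ ] q)))
lemma3p5 ℓ qs q p =
    SQW⇒W
  , mk⇔ (λ H → ⊨SQW-of-⊨W q ((p ⇛ p) ⇛ q) H (λ A ρ → sym (RegularPart.⇒-self-⇒ A _ _)))
        (λ H → ⊨W-of-⊨SQW ((p ⇛ p) ⇛ q) q H (λ M ρ → WAlg.w4 M _ _))
  , λ q-reg → mk⇔ (λ H → ⊨SQW-of-⊨W q q H (λ A ρ → RegularPart.reg-eval A ρ q q-reg)) SQW⇒W
  where
  SQW⇒W : qs ⊨SQW[ ℓ ] q → qs ⊨W[ ℓ ] q
  SQW⇒W H = ⊨W-of-⊨SQW q q H (λ _ _ → refl)
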